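{- Let $k \ge 2$, $G$ a $k$-dicritical digraph and $(V_0, V_1)$ a partition of $V(G)$ such that $\lvert A(V_0, V_1)\rvert \le k-1$. Let $V_0^* = N^-(V_1)$ and $V_1^* = N^+(V_0)$. Then there is $i \in \{0, 1\}$ such that, for any $(k-1)$-dicolouring $\phi_i$ of $G[V_i]$, $\lvert \phi_i(V_i^*)\rvert = 1$ and, for any $(k-1)$-dicolouring $\phi_{1-i}$ of $G[V_{1-i}]$, $\lvert \phi_{1-i}(V_{1-i}^*)\rvert = k-1$.
   Context: $G$ is $k$-dicritical if its dichromatic number (minimum number of parts in a partition of $V(G)$ into sets inducing acyclic subdigraphs) is $k$ and every proper subdigraph has dichromatic number at most $k-1$. $A(V_0,V_1)$ is the set of arcs from $V_0$ to $V_1$. For a vertex set $Y$, $N^-(Y)$ is the set of vertices outside $Y$ having an arc into $Y$, and $N^+(Y)$ the set of vertices outside $Y$ receiving an arc from $Y$; thus $V_0^*\subseteq V_0$ are tails and $V_1^*\subseteq V_1$ heads of arcs from $V_0$ to $V_1$. -}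

module Defs where

open import Data.Nat using (ℕ; zero; suc; _+_; _∸_; _≤_)
open import Data.Bool using (Bool; true; false; _∧_; not; if_then_else_)
open import Data.Fin using (Fin; _≟_)
open import Data.Fin.Subset using (Subset; ∁; ∣_∣; Nonempty)
open import Data.Vec using (lookup; tabulate)
open import Data.List using (List; allFin; map)
open import Data.Nat.ListAction using (sum)
open import Data.Bool.ListAction using (any)
open import Data.Product using (Σ; _×_; ∃; ∃-syntax; _,_)
open import Data.Sum using (_⊎_)
open import Relation.Nullary using (¬_)
open import Relation.Nullary.Decidable using (⌊_⌋)
open import Relation.Binary.PropositionalEquality using (_≡_)
open import Relation.Binary.Construct.Closure.Transitive using (TransClosure)

-- A (simple, loopless) digraph on vertex set Fin n; arc u v ≡ true means u → v.
-- (Digons u → v, v → u are allowed, as usual for dicolouring.)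
record Digraph (n : ℕ) : Set where
  field
    arc      : Fin n → Fin n → Bool
    loopless : ∀ v → arc v v ≡ false
open Digraph public

_∈ˢ_ : ∀ {n} → Fin n → Subset n → Set
v ∈ˢ S = lookup S v ≡ true

-- A c-dicolouring of the subdigraph with vertex set S and arc set B (arcs of B
-- are only considered between vertices of S): a map φ into c colours such that
-- every colour class induces an acyclic subdigraph, i.e. there is no directed
-- cycle (closed directed walk of length ≥ 1) using only arcs of B inside S
-- whose vertices all receive the same colour.
MonoArc : ∀ {n c} → Subset n → (Fin n → Fin n → Bool) → (Fin n → Fin c)
        → Fin n → Fin n → Set
MonoArc S B φ u v = (u ∈ˢ S) × (v ∈ˢ S) × (B u v ≡ true) × (φ u ≡ φ v)

IsDicolouring : ∀ {n} (c : ℕ) → Subset n → (Fin n → Fin n → Bool)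
              → (Fin n → Fin c) → Set
IsDicolouring c S B φ = ∀ x → ¬ TransClosure (MonoArc S B φ) x x

Dicolourable : ∀ {n} (c : ℕ) → Subset n → (Fin n → Fin n → Bool) → Set
Dicolourable c S B = ∃[ φ ] IsDicolouring c S B φ

full : ∀ {n} → Subset n
full = tabulate (λ _ → true)

IsSubdigraph : ∀ {n} → Digraph n → Subset n → (Fin n → Fin n → Bool) → Set
IsSubdigraph G S B = ∀ u v → B u v ≡ true →
  (arc G u v ≡ true) × (u ∈ˢ S) × (v ∈ˢ S)

IsProper : ∀ {n} → Digraph n → Subset n → (Fin n → Fin n → Bool) → Set
IsProper G S B = (∃[ v ] lookup S v ≡ false)
               ⊎ (∃[ u ] ∃[ v ] (arc G u v ≡ true) × (B u v ≡ false))

DichromaticNumberIs : ∀ {n} → Digraph n → ℕ → Set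
DichromaticNumberIs G k =
  Dicolourable k full (arc G) × ¬ Dicolourable (k ∸ 1) full (arc G)

Dicritical : ∀ {n} → ℕ → Digraph n → Set
Dicritical k G = DichromaticNumberIs G k ×
  (∀ S B → IsSubdigraph G S B → IsProper G S B → Dicolourable (k ∸ 1) S B)

countArcs : ∀ {n} → Digraph n → Subset n → Subset n → ℕ
countArcs {n} G X Y = sum (map (λ u → sum (map (λ v →
  if lookup X u ∧ lookup Y v ∧ arc G u v then 1 else 0) (allFin n))) (allFin n))

N⁻ : ∀ {n} → Digraph n → Subset n → Subset n
N⁻ {n} G Y = tabulate (λ u → not (lookup Y u) ∧
  any (λ v → lookup Y v ∧ arc G u v) (allFin n))

N⁺ : ∀ {n} → Digraph n → Subset n → Subset n
N⁺ {n} G Y = tabulate (λ v → not (lookup Y v) ∧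
  any (λ u → lookup Y u ∧ arc G u v) (allFin n))

image : ∀ {n c} → (Fin n → Fin c) → Subset n → Subset c
image {n} φ X = tabulate (λ j → any (λ v → lookup X v ∧ ⌊ φ v ≟ j ⌋) (allFin n))

Conclusion : ∀ {n} → Digraph n → ℕ → Subset n → Subset n → Subset n → Subset n → Set
Conclusion G k Vi Vi* Vj Vj* =
  (∀ φ → IsDicolouring (k ∸ 1) Vi (arc G) φ → ∣ image φ Vi* ∣ ≡ 1) ×
  (∀ φ → IsDicolouring (k ∸ 1) Vj (arc G) φ → ∣ image φ Vj* ∣ ≡ k ∸ 1)

-- The halves G[V₀] and G[V₁] are (k-1)-dicolourable while G is not.  Given dicolourings
-- φ₀ of G[V₀], φ₁ of G[V₁] and a permutation σ of the k-1 colours, φ₀ ∪ σ ∘ φ₁ dicolours G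
-- unless some arc uv from V₀ to V₁ has φ₀ u = σ (φ₁ v), since a cycle meeting both sides
-- leaves V₀ along such an arc.  So the at most k-1 cells (φ₀ u , φ₁ v) of the colour grid,
-- one per arc of A(V₀,V₁), meet every permutation matrix, and a König-type argument shows
-- they then fill a row (|φ₀(V₀*)| = 1, |φ₁(V₁*)| = k-1) or a column (the reverse).  Pairing
-- each dicolouring with a fixed one of the other side shows the alternative is the same
-- for all dicolourings.
module Submission where

open import Defs
open import Data.Nat using (ℕ; suc; _+_; _∸_; _≤_; _<_; _%_; s≤s; NonZero)
open import Data.Nat.Properties using (≤-trans; ≤-reflexive; 1+n≰n; +-comm; +-assoc; m+[n∸m]≡n; <⇒≤)
open import Data.Nat.DivMod using (_mod_; m%n<n; %-distribˡ-+; m%n%n≡m%n; [m+n]%n≡m%n; m<n⇒m%n≡m; n%n≡0)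
open import Data.Nat.ListAction using (sum)
open import Data.Bool using (Bool; true; false; _∧_; not; if_then_else_)
open import Data.Bool.Properties using (∧-conicalˡ; ∧-conicalʳ; T-≡; not-injective)
open import Data.Bool.ListAction using (any)
open import Data.Fin using (Fin; toℕ; punchOut)
open import Data.Fin.Properties
  using (_≟_; any?; all?; ¬∀⟶∃¬; injective⇒≤; punchOut-injective; toℕ-fromℕ<; toℕ-injective; toℕ<n)
import Data.Fin.Permutation.Components as PC
open import Data.Fin.Subset using (Subset; ∁; ∣_∣; ⁅_⁆; ⊤; _∈_; Nonempty)
open import Data.Fin.Subset.Properties using (⊆-antisym; ⊆⊤; x∈⁅x⁆; x∈⁅y⁆⇒x≡y; ∣⁅x⁆∣≡1; ∣⊤∣≡n)
open import Data.Vec using (lookup)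
open import Data.Vec.Properties using (lookup-map; lookup∘tabulate; lookup⇒[]=; []=⇒lookup)
open import Data.List as List using (List; []; _∷_; length; map; concatMap; allFin)
open import Data.List.Properties using (length-++; map-cong)
open import Data.List.Relation.Unary.Any using (here; satisfied; index)
open import Data.List.Relation.Unary.Any.Properties using (any⁺; any⁻; lookup-index)
open import Data.List.Membership.Propositional using (lose) renaming (_∈_ to _∈ˡ_)
open import Data.List.Membership.Propositional.Properties using (∈-allFin; ∈-lookup; ∈-concatMap⁺; ∈-concatMap⁻)
open import Data.Product as Product using (_×_; _,_; proj₁; proj₂; ∃)
open import Data.Product.Properties using (≡-dec; ,-injectiveˡ; ,-injectiveʳ)
open import Data.Sum as Sum using (_⊎_; inj₁; inj₂)
open import Data.Empty using (⊥; ⊥-elim)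
open import Function using (_∘_; id; case_of_; Equivalence)
open import Function.Definitions using (Injective)
open import Relation.Nullary using (Dec; yes; no; ¬_; contradiction; does)
open import Relation.Nullary.Decidable using (dec-true; dec-false; toWitness; fromWitness)
open import Relation.Binary.PropositionalEquality hiding ([_])
open import Relation.Binary.Construct.Closure.Transitive using (TransClosure; [_]; _∷_)

open Equivalence using (to; from)

injective⇒surjective : ∀ {m n} {f : Fin m → Fin n} → n ≤ m → Injective _≡_ _≡_ f →
                       ∀ y → ∃ λ x → f x ≡ y
injective⇒surjective {n = suc _} {f} n≤m f-inj y with any? (λ x → f x ≟ y)
... | yes hit = hit
... | no miss = contradiction (≤-trans n≤m (injective⇒≤ punched-inj)) 1+n≰n
  where
  y≢f : ∀ x → y ≢ f x
  y≢f x y≡fx = miss (x , sym y≡fx)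
  punched-inj : Injective _≡_ _≡_ (λ x → punchOut (y≢f x))
  punched-inj {x} {x′} = f-inj ∘ punchOut-injective (y≢f x) (y≢f x′)

surjective⇒injective : ∀ {m n} {f : Fin m → Fin n} → m ≤ n → (∀ y → ∃ λ x → f x ≡ y) →
                       Injective _≡_ _≡_ f
surjective⇒injective {m} {n} {f} m≤n onto {x} {x′} fx≡fx′ = begin
  x              ≡⟨ sym (section-retracts x) ⟩
  section (f x)  ≡⟨ cong section fx≡fx′ ⟩
  section (f x′) ≡⟨ section-retracts x′ ⟩
  x′             ∎
  where
  open ≡-Reasoning
  section : Fin n → Fin m
  section y = proj₁ (onto y)
  section-inj : Injective _≡_ _≡_ section
  section-inj {y} {y′} e = trans (sym (proj₂ (onto y))) (trans (cong f e) (proj₂ (onto y′)))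
  section-retracts : ∀ x → section (f x) ≡ x
  section-retracts x with y , sy≡x ← injective⇒surjective m≤n section-inj x =
    trans (cong (section ∘ f) (sym sy≡x)) (trans (cong section (proj₂ (onto y))) sy≡x)

transpose-matchˡ : ∀ {n} (i j : Fin n) → PC.transpose i j i ≡ j
transpose-matchˡ i j rewrite dec-true (i ≟ i) refl = refl

transpose-matchʳ : ∀ {n} (i j : Fin n) → PC.transpose i j j ≡ i
transpose-matchʳ i j with j ≟ i
... | yes j≡i = j≡i
... | no _ rewrite dec-true (j ≟ j) refl = refl

transpose-fixes : ∀ {n} {i j k : Fin n} → k ≢ i → k ≢ j → PC.transpose i j k ≡ k
transpose-fixes {i = i} {j} {k} k≢i k≢j rewrite dec-false (k ≟ i) k≢i | dec-false (k ≟ j) k≢j = refl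

transpose-injective : ∀ {n} (i j : Fin n) → Injective _≡_ _≡_ (PC.transpose i j)
transpose-injective i j {k} {k′} e =
  trans (sym (PC.transpose-inverse j i)) (trans (cong (PC.transpose j i) e) (PC.transpose-inverse j i))

[[a+b]%c+[c∸b]]%c≡a : ∀ {a b c} .{{_ : NonZero c}} → a < c → b ≤ c → ((a + b) % c + (c ∸ b)) % c ≡ a
[[a+b]%c+[c∸b]]%c≡a {a} {b} {c} a<c b≤c = begin
  ((a + b) % c + (c ∸ b)) % c         ≡⟨ %-distribˡ-+ ((a + b) % c) (c ∸ b) c ⟩
  ((a + b) % c % c + (c ∸ b) % c) % c ≡⟨ cong (λ r → (r + (c ∸ b) % c) % c) (m%n%n≡m%n (a + b) c) ⟩
  ((a + b) % c + (c ∸ b) % c) % c     ≡⟨ sym (%-distribˡ-+ (a + b) (c ∸ b) c) ⟩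
  (a + b + (c ∸ b)) % c               ≡⟨ cong (_% c) (trans (+-assoc a b (c ∸ b)) (cong (a +_) (m+[n∸m]≡n b≤c))) ⟩
  (a + c) % c                         ≡⟨ [m+n]%n≡m%n a c ⟩
  a % c                               ≡⟨ m<n⇒m%n≡m a<c ⟩
  a                                   ∎
  where open ≡-Reasoning

-- Permutation matrices in the colour grid

Cell : ℕ → Set
Cell c = Fin c × Fin c

-- The graphs of the shifts y ↦ t + y (mod c) partition the grid, and difference reads off t.
module Cyclic {c : ℕ} .{{_ : NonZero c}} where

  shift : Fin c → Fin c → Fin c
  shift t y = (toℕ t + toℕ y) mod c

  difference : Cell c → Fin c
  difference (x , y) = (toℕ x + (c ∸ toℕ y)) mod c

  toℕ-mod : ∀ a → toℕ (a mod c) ≡ a % c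
  toℕ-mod a = toℕ-fromℕ< (m%n<n a c)

  difference-shift : ∀ t y → difference (shift t y , y) ≡ t
  difference-shift t y = toℕ-injective (begin
    toℕ (difference (shift t y , y))               ≡⟨ toℕ-mod _ ⟩
    (toℕ (shift t y) + (c ∸ toℕ y)) % c            ≡⟨ cong (λ r → (r + (c ∸ toℕ y)) % c) (toℕ-mod _) ⟩
    ((toℕ t + toℕ y) % c + (c ∸ toℕ y)) % c        ≡⟨ [[a+b]%c+[c∸b]]%c≡a (toℕ<n t) (<⇒≤ (toℕ<n y)) ⟩
    toℕ t                                          ∎)
    where open ≡-Reasoning

  shift-injective : ∀ t → Injective _≡_ _≡_ (shift t)
  shift-injective t {y} {y′} e = toℕ-injective (begin
    toℕ y                                    ≡⟨ sym (unshift y) ⟩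
    (toℕ (shift t y) + (c ∸ toℕ t)) % c      ≡⟨ cong (λ s → (toℕ s + (c ∸ toℕ t)) % c) e ⟩
    (toℕ (shift t y′) + (c ∸ toℕ t)) % c     ≡⟨ unshift y′ ⟩
    toℕ y′                                   ∎)
    where
    open ≡-Reasoning
    unshift : ∀ y → (toℕ (shift t y) + (c ∸ toℕ t)) % c ≡ toℕ y
    unshift y = begin
      (toℕ (shift t y) + (c ∸ toℕ t)) % c      ≡⟨ cong (λ r → (r + (c ∸ toℕ t)) % c) (toℕ-mod _) ⟩
      ((toℕ t + toℕ y) % c + (c ∸ toℕ t)) % c  ≡⟨ cong (λ r → (r % c + (c ∸ toℕ t)) % c) (+-comm (toℕ t) (toℕ y)) ⟩
      ((toℕ y + toℕ t) % c + (c ∸ toℕ t)) % c  ≡⟨ [[a+b]%c+[c∸b]]%c≡a (toℕ<n y) (<⇒≤ (toℕ<n t)) ⟩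
      toℕ y                                    ∎

  toℕ-difference-diagonal : ∀ x → toℕ (difference (x , x)) ≡ 0
  toℕ-difference-diagonal x = trans (toℕ-mod _) (trans (cong (_% c) (m+[n∸m]≡n (<⇒≤ (toℕ<n x)))) (n%n≡0 c))

  difference-diagonal : ∀ x y → difference (x , x) ≡ difference (y , y)
  difference-diagonal x y = toℕ-injective (trans (toℕ-difference-diagonal x) (sym (toℕ-difference-diagonal y)))

_∈ᶜ_ : ∀ {m c} → Cell c → (Fin m → Cell c) → Set
p ∈ᶜ cell = ∃ λ i → cell i ≡ p

_∈ᶜ?_ : ∀ {m c} (p : Cell c) (cell : Fin m → Cell c) → Dec (p ∈ᶜ cell)
p ∈ᶜ? cell = any? (λ i → ≡-dec _≟_ _≟_ (cell i) p)

-- The permutation matrix of σ has its entries at the cells (σ y , y).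
Meets : ∀ {m c} → (Fin m → Cell c) → (Fin c → Fin c) → Set
Meets cell σ = ∃ λ y → (σ y , y) ∈ᶜ cell

FullRow : ∀ {m c} → (Fin m → Cell c) → Fin c → Set
FullRow cell r = (∀ i → proj₁ (cell i) ≡ r) × (∀ y → (r , y) ∈ᶜ cell)

FullColumn : ∀ {m c} → (Fin m → Cell c) → Fin c → Set
FullColumn cell s = (∀ i → proj₂ (cell i) ≡ s) × (∀ x → (x , s) ∈ᶜ cell)

surjectiveKey⇒injective : ∀ {m c} {cell : Fin m → Cell c} → m ≤ c → (key : Cell c → Fin c) →
                          (∀ t → ∃ λ p → p ∈ᶜ cell × key p ≡ t) →
                          ∀ {p q} → p ∈ᶜ cell → q ∈ᶜ cell → key p ≡ key q → p ≡ q
surjectiveKey⇒injective {cell = cell} m≤c key onto (i , refl) (i′ , refl) same =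
  cong cell (surjective⇒injective m≤c keys-onto same)
  where
  keys-onto : ∀ t → ∃ λ i → key (cell i) ≡ t
  keys-onto t with p , (i , refl) , kp≡t ← onto t = i , kp≡t

-- The shifts force a unique diagonal cell (j , j); the transpositions (j y) then force a cell
-- on each line through it, and a 3-cycle forbids using both row j and column j.
module _ {m c : ℕ} .{{_ : NonZero c}} {cell : Fin m → Cell c} (m≤c : m ≤ c)
         (meets : ∀ σ → Injective _≡_ _≡_ σ → Meets cell σ) where
  open Cyclic

  -- All c shifts are met, by at most c cells, so difference separates the cells.
  diagonal-unique : ∀ {x y} → (x , x) ∈ᶜ cell → (y , y) ∈ᶜ cell → x ≡ y
  diagonal-unique {x} {y} xx∈ yy∈ =
    ,-injectiveˡ (surjectiveKey⇒injective m≤c difference differences-onto xx∈ yy∈ (difference-diagonal x y))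
    where
    differences-onto : ∀ t → ∃ λ p → p ∈ᶜ cell × difference p ≡ t
    differences-onto t with y , p∈ ← meets (shift t) (shift-injective t) = _ , p∈ , difference-shift t y

  module _ (j : Fin c) (jj∈ : (j , j) ∈ᶜ cell) where

    rowOrColumnCell : ∀ {y} → y ≢ j → (j , y) ∈ᶜ cell ⊎ (y , j) ∈ᶜ cell
    rowOrColumnCell {y} y≢j with z , z∈ ← meets (PC.transpose j y) (transpose-injective j y) =
      case ((z ≟ j) , (z ≟ y)) of λ where
        (yes refl , _)        → inj₂ (subst (λ x → (x , j) ∈ᶜ cell) (transpose-matchˡ j y) z∈)
        (no _     , yes refl) → inj₁ (subst (λ x → (x , y) ∈ᶜ cell) (transpose-matchʳ j y) z∈)
        (no z≢j   , no z≢y)   →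
          contradiction (diagonal-unique (subst (λ x → (x , z) ∈ᶜ cell) (transpose-fixes z≢j z≢y) z∈) jj∈) z≢j

    lineKey : Cell c → Fin c
    lineKey (x , y) = if does (y ≟ j) then x else y

    lineKey-column : ∀ x → lineKey (x , j) ≡ x
    lineKey-column x rewrite dec-true (j ≟ j) refl = refl

    lineKey-row : ∀ y → lineKey (j , y) ≡ y
    lineKey-row y with y ≟ j
    ... | yes refl = refl
    ... | no _     = refl

    lineKey-off : ∀ {x y} → y ≢ j → lineKey (x , y) ≡ y
    lineKey-off {y = y} y≢j rewrite dec-false (y ≟ j) y≢j = refl

    lineKey-injective : ∀ {p q} → p ∈ᶜ cell → q ∈ᶜ cell → lineKey p ≡ lineKey q → p ≡ q
    lineKey-injective = surjectiveKey⇒injective m≤c lineKey lineKeys-onto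
      where
      lineKeys-onto : ∀ t → ∃ λ p → p ∈ᶜ cell × lineKey p ≡ t
      lineKeys-onto t with t ≟ j
      ... | yes refl = _ , jj∈ , lineKey-column j
      ... | no t≢j with rowOrColumnCell t≢j
      ...   | inj₁ jt∈ = _ , jt∈ , lineKey-row t
      ...   | inj₂ tj∈ = _ , tj∈ , lineKey-column t

    inRowOrColumn : ∀ {x y} → (x , y) ∈ᶜ cell → x ≡ j ⊎ y ≡ j
    inRowOrColumn {x} {y} xy∈ with y ≟ j
    ... | yes y≡j = inj₂ y≡j
    ... | no y≢j with rowOrColumnCell y≢j
    ...   | inj₁ jy∈ =
      inj₁ (,-injectiveˡ (lineKey-injective xy∈ jy∈ (trans (lineKey-off y≢j) (sym (lineKey-row y)))))
    ...   | inj₂ yj∈ =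
      contradiction (,-injectiveʳ (lineKey-injective xy∈ yj∈ (trans (lineKey-off y≢j) (sym (lineKey-column y))))) y≢j

    transposed⇒diagonal : ∀ {x y} → (x , y) ∈ᶜ cell → (y , x) ∈ᶜ cell → x ≡ y
    transposed⇒diagonal {x} {y} xy∈ yx∈ with inRowOrColumn xy∈
    ... | inj₁ refl = ,-injectiveˡ (lineKey-injective xy∈ yx∈ (trans (lineKey-row y) (sym (lineKey-column y))))
    ... | inj₂ refl = ,-injectiveˡ (lineKey-injective xy∈ yx∈ (trans (lineKey-column x) (sym (lineKey-row x))))

    fullRow : (∀ y → (j , y) ∈ᶜ cell) → FullRow cell j
    fullRow row = inRow , row
      where
      inRow : ∀ i → proj₁ (cell i) ≡ j
      inRow i with inRowOrColumn (i , refl)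
      ... | inj₁ x≡j = x≡j
      ... | inj₂ y≡j =
        trans (transposed⇒diagonal (i , refl) (subst (λ y → (y , proj₁ (cell i)) ∈ᶜ cell) (sym y≡j) (row _))) y≡j

    fullColumn : (∀ x → (x , j) ∈ᶜ cell) → FullColumn cell j
    fullColumn column = inColumn , column
      where
      inColumn : ∀ i → proj₂ (cell i) ≡ j
      inColumn i with inRowOrColumn (i , refl)
      ... | inj₂ y≡j = y≡j
      ... | inj₁ x≡j =
        trans (sym (transposed⇒diagonal (i , refl) (subst (λ x → (proj₂ (cell i) , x) ∈ᶜ cell) (sym x≡j) (column _)))) x≡j

    -- A permutation sending j₁ ↦ j and j ↦ j₂ would avoid every cell in row j or column j.
    missingRowAndColumn : ∀ {j₁ j₂} → ¬ (j , j₁) ∈ᶜ cell → ¬ (j₂ , j) ∈ᶜ cell → ⊥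
    missingRowAndColumn {j₁} {j₂} jj₁∉ j₂j∉ = avoids (meets ρ ρ-injective)
      where
      j≢j₁ : j ≢ j₁
      j≢j₁ refl = jj₁∉ jj∈
      j≢j₂ : j ≢ j₂
      j≢j₂ refl = j₂j∉ jj∈
      ρ : Fin c → Fin c
      ρ = PC.transpose j j₂ ∘ PC.transpose j₁ j₂
      ρ-injective : Injective _≡_ _≡_ ρ
      ρ-injective e = transpose-injective j₁ j₂ (transpose-injective j j₂ e)
      ρj₁≡j : ρ j₁ ≡ j
      ρj₁≡j = trans (cong (PC.transpose j j₂) (transpose-matchˡ j₁ j₂)) (transpose-matchʳ j j₂)
      ρj≡j₂ : ρ j ≡ j₂
      ρj≡j₂ = trans (cong (PC.transpose j j₂) (transpose-fixes j≢j₁ j≢j₂)) (transpose-matchˡ j j₂)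
      avoids : ¬ Meets cell ρ
      avoids (y , ρy,y∈) with inRowOrColumn ρy,y∈
      ... | inj₁ ρy≡j with refl ← ρ-injective {y} {j₁} (trans ρy≡j (sym ρj₁≡j)) =
        jj₁∉ (subst (λ x → (x , j₁) ∈ᶜ cell) ρy≡j ρy,y∈)
      ... | inj₂ refl = j₂j∉ (subst (λ x → (x , j) ∈ᶜ cell) ρj≡j₂ ρy,y∈)

    fullLineThrough : ∃ (FullRow cell) ⊎ ∃ (FullColumn cell)
    fullLineThrough with all? (λ y → (j , y) ∈ᶜ? cell) | all? (λ x → (x , j) ∈ᶜ? cell)
    ... | yes row | _          = inj₁ (j , fullRow row)
    ... | no _    | yes column = inj₂ (j , fullColumn column)
    ... | no ¬row | no ¬column =
      ⊥-elim (missingRowAndColumn (proj₂ (¬∀⟶∃¬ c _ (λ y → (j , y) ∈ᶜ? cell) ¬row))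
                                  (proj₂ (¬∀⟶∃¬ c _ (λ x → (x , j) ∈ᶜ? cell) ¬column)))

  meetsAllPermutations⇒fullLine : ∃ (FullRow cell) ⊎ ∃ (FullColumn cell)
  meetsAllPermutations⇒fullLine with j , jj∈ ← meets id id = fullLineThrough j jj∈

∧-true⁻ : ∀ {a b} → a ∧ b ≡ true → a ≡ true × b ≡ true
∧-true⁻ e = ∧-conicalˡ _ _ e , ∧-conicalʳ _ _ e

∧-true⁺ : ∀ {a b} → a ≡ true → b ≡ true → a ∧ b ≡ true
∧-true⁺ refl refl = refl

any-true⁺ : ∀ {A : Set} (f : A → Bool) {x xs} → x ∈ˡ xs → f x ≡ true → any f xs ≡ true
any-true⁺ f x∈ fx = to T-≡ (any⁺ f (lose x∈ (from T-≡ fx)))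

any-true⁻ : ∀ {A : Set} (f : A → Bool) xs → any f xs ≡ true → ∃ λ x → f x ≡ true
any-true⁻ f xs e = Product.map₂ (to T-≡) (satisfied (any⁻ f xs (from T-≡ e)))

length-concatMap : ∀ {A B : Set} (f : A → List B) xs → length (concatMap f xs) ≡ sum (map (length ∘ f) xs)
length-concatMap f []       = refl
length-concatMap f (x ∷ xs) = trans (length-++ (f x)) (cong (length (f x) +_) (length-concatMap f xs))

∈-if⁻ : ∀ {A : Set} {x y : A} b → x ∈ˡ (if b then y ∷ [] else []) → b ≡ true × x ≡ y
∈-if⁻ true (here x≡y) = refl , x≡y

module _ {A : Set} (p : A → A → Bool) where

  private
    pairIf : A → A → List (A × A)
    pairIf u v = if p u v then (u , v) ∷ [] else []

    pairsFrom : List A → A → List (A × A)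
    pairsFrom xs u = concatMap (pairIf u) xs

  pairsWhere : List A → List (A × A)
  pairsWhere xs = concatMap (pairsFrom xs) xs

  length-pairsWhere : ∀ xs → length (pairsWhere xs) ≡ sum (map (λ u → sum (map (λ v → if p u v then 1 else 0) xs)) xs)
  length-pairsWhere xs = trans (length-concatMap _ xs) (cong sum (map-cong (λ u →
    trans (length-concatMap _ xs) (cong sum (map-cong (λ v → length-if (p u v)) xs))) xs))
    where
    length-if : ∀ {x : A × A} b → length (if b then x ∷ [] else []) ≡ (if b then 1 else 0)
    length-if true  = refl
    length-if false = refl

  ∈-pairsWhere⁺ : ∀ {u v xs} → u ∈ˡ xs → v ∈ˡ xs → p u v ≡ true → (u , v) ∈ˡ pairsWhere xs
  ∈-pairsWhere⁺ {u} {v} u∈ v∈ puv = ∈-concatMap⁺ _ (lose u∈ (∈-concatMap⁺ _ (lose v∈ uv∈)))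
    where
    uv∈ : (u , v) ∈ˡ (if p u v then (u , v) ∷ [] else [])
    uv∈ rewrite puv = here refl

  ∈-pairsWhere⁻ : ∀ {u v} xs → (u , v) ∈ˡ pairsWhere xs → p u v ≡ true
  ∈-pairsWhere⁻ xs uv∈
    with u′ , uv∈′ ← satisfied (∈-concatMap⁻ (pairsFrom xs) {xs = xs} uv∈)
    with v′ , uv∈″ ← satisfied (∈-concatMap⁻ (pairIf u′) {xs = xs} uv∈′)
    with puv , refl ← ∈-if⁻ {y = u′ , v′} (p u′ v′) uv∈″ = puv

module _ {n} (p : Subset n) (v : Fin n) where

  ∈∁⁺ : lookup p v ≡ false → v ∈ˢ ∁ p
  ∈∁⁺ e = trans (lookup-map v not p) (cong not e)

  ∈∁⁻ : v ∈ˢ ∁ p → lookup p v ≡ false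
  ∈∁⁻ e = not-injective (trans (sym (lookup-map v not p)) e)

  ∉∁⁺ : v ∈ˢ p → lookup (∁ p) v ≡ false
  ∉∁⁺ e = trans (lookup-map v not p) (cong not e)

  ∉∁⁻ : lookup (∁ p) v ≡ false → v ∈ˢ p
  ∉∁⁻ e = not-injective (trans (sym (lookup-map v not p)) e)

module _ {n c} (φ : Fin n → Fin c) {X : Subset n} where

  ∈-image⁺ : ∀ {v} → v ∈ˢ X → φ v ∈ image φ X
  ∈-image⁺ {v} v∈X = lookup⇒[]= (φ v) (image φ X) (trans (lookup∘tabulate _ (φ v))
    (any-true⁺ _ (∈-allFin v) (∧-true⁺ v∈X (to T-≡ (fromWitness refl)))))

  ∈-image⁻ : ∀ {j} → j ∈ image φ X → ∃ λ v → v ∈ˢ X × φ v ≡ j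
  ∈-image⁻ {j} j∈
    with v , e ← any-true⁻ _ (allFin n) (trans (sym (lookup∘tabulate _ j)) ([]=⇒lookup j∈))
    with v∈X , φv≟j ← ∧-true⁻ e = v , v∈X , toWitness (from T-≡ φv≟j)

  ∣image∣≡1 : ∀ {v} → v ∈ˢ X → (∀ {w} → w ∈ˢ X → φ w ≡ φ v) → ∣ image φ X ∣ ≡ 1
  ∣image∣≡1 {v} v∈X constant = trans (cong ∣_∣ (⊆-antisym image⊆ ⊆image)) (∣⁅x⁆∣≡1 (φ v))
    where
    image⊆ : ∀ {j} → j ∈ image φ X → j ∈ ⁅ φ v ⁆
    image⊆ j∈ with w , w∈X , refl ← ∈-image⁻ j∈ = subst (_∈ ⁅ φ v ⁆) (sym (constant w∈X)) (x∈⁅x⁆ (φ v))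
    ⊆image : ∀ {j} → j ∈ ⁅ φ v ⁆ → j ∈ image φ X
    ⊆image j∈ with refl ← x∈⁅y⁆⇒x≡y (φ v) j∈ = ∈-image⁺ v∈X

  ∣image∣≡c : (∀ j → ∃ λ v → v ∈ˢ X × φ v ≡ j) → ∣ image φ X ∣ ≡ c
  ∣image∣≡c onto = trans (cong ∣_∣ (⊆-antisym ⊆⊤ ⊤⊆image)) (∣⊤∣≡n c)
    where
    ⊤⊆image : ∀ {j} → j ∈ ⊤ → j ∈ image φ X
    ⊤⊆image {j} _ with v , v∈X , refl ← onto j = ∈-image⁺ v∈X

-- Dicolourings

TransClosure-map : ∀ {A : Set} {R S : A → A → Set} → (∀ {x y} → R x y → S x y) →
                   ∀ {x y} → TransClosure R x y → TransClosure S x y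
TransClosure-map f [ r ]    = [ f r ]
TransClosure-map f (r ∷ rs) = f r ∷ TransClosure-map f rs

module _ {n c c′} {S S′ : Subset n} {B B′ : Fin n → Fin n → Bool} {φ : Fin n → Fin c} {φ′ : Fin n → Fin c′} where

  dicolouring-reflect : (∀ {u v} → MonoArc S B φ u v → MonoArc S′ B′ φ′ u v) →
                        IsDicolouring c′ S′ B′ φ′ → IsDicolouring c S B φ
  dicolouring-reflect mono d x cycle = d x (TransClosure-map mono cycle)

∘-dicolouring : ∀ {n c c′} {S : Subset n} {B} {φ : Fin n → Fin c} {σ : Fin c → Fin c′} →
                Injective _≡_ _≡_ σ → IsDicolouring c S B φ → IsDicolouring c′ S B (σ ∘ φ)
∘-dicolouring {S = S} σ-inj = dicolouring-reflect {S = S} {S′ = S} λ (u∈ , v∈ , a , e) → u∈ , v∈ , a , σ-inj e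

inducedArcs : ∀ {n} → Digraph n → Subset n → Fin n → Fin n → Bool
inducedArcs G S u w = lookup S u ∧ lookup S w ∧ arc G u w

inducedArcs-isSubdigraph : ∀ {n} (G : Digraph n) (S : Subset n) → IsSubdigraph G S (inducedArcs G S)
inducedArcs-isSubdigraph G S u w e with u∈ , rest ← ∧-true⁻ e with w∈ , a ← ∧-true⁻ rest = a , u∈ , w∈

induced-dicolourable : ∀ {n c} (G : Digraph n) {S : Subset n} →
                       (∀ S′ B → IsSubdigraph G S′ B → IsProper G S′ B → Dicolourable c S′ B) →
                       ∀ {v} → lookup S v ≡ false → Dicolourable c S (arc G)
induced-dicolourable G {S} critical {v} v∉S
  with φ , φ-dicol ← critical S (inducedArcs G S) (inducedArcs-isSubdigraph G S) (inj₁ (v , v∉S)) =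
  φ , dicolouring-reflect {S = S} {S′ = S} (λ (u∈ , w∈ , a , e) → u∈ , w∈ , ∧-true⁺ u∈ (∧-true⁺ w∈ a) , e) φ-dicol

source : ∀ {n c} {S : Subset n} {B} {φ : Fin n → Fin c} {u v} → TransClosure (MonoArc S B φ) u v → u ∈ˢ S
source [ r ]   = proj₁ r
source (r ∷ _) = proj₁ r

module Merge {n c} (B : Fin n → Fin n → Bool) (V₀ : Subset n) {φ₀ φ₁ : Fin n → Fin c}
             (φ₀-dicol : IsDicolouring c V₀ B φ₀) (φ₁-dicol : IsDicolouring c (∁ V₀) B φ₁)
             (rainbowCrossing : ∀ {u v} → u ∈ˢ V₀ → v ∈ˢ ∁ V₀ → B u v ≡ true → φ₀ u ≢ φ₁ v) where

  merge : Fin n → Fin c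
  merge x = if lookup V₀ x then φ₀ x else φ₁ x

  merge-in : ∀ {x} → x ∈ˢ V₀ → merge x ≡ φ₀ x
  merge-in e rewrite e = refl

  merge-out : ∀ {x} → lookup V₀ x ≡ false → merge x ≡ φ₁ x
  merge-out e rewrite e = refl

  -- A monochromatic arc leaving V₀ would be a monochromatic crossing arc.
  stays-in : ∀ {u v} → MonoArc full B merge u v → u ∈ˢ V₀ → MonoArc V₀ B φ₀ u v
  stays-in {u} {v} (_ , _ , a , e) u∈ with lookup V₀ v in v?
  ... | true  = u∈ , refl , a , trans (sym (merge-in u∈)) e
  ... | false = ⊥-elim (rainbowCrossing u∈ (∈∁⁺ V₀ v v?) a (trans (sym (merge-in u∈)) e))

  stays-out : ∀ {u v} → MonoArc full B merge u v → lookup V₀ v ≡ false → MonoArc (∁ V₀) B φ₁ u v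
  stays-out {u} {v} (_ , _ , a , e) v∉ with lookup V₀ u in u?
  ... | true  = ⊥-elim (rainbowCrossing u? (∈∁⁺ V₀ v v∉) a (trans e (merge-out v∉)))
  ... | false = ∈∁⁺ V₀ u u? , ∈∁⁺ V₀ v v∉ , a , trans e (merge-out v∉)

  walk-in : ∀ {u v} → TransClosure (MonoArc full B merge) u v → u ∈ˢ V₀ → TransClosure (MonoArc V₀ B φ₀) u v
  walk-in [ r ]    u∈ = [ stays-in r u∈ ]
  walk-in (r ∷ rs) u∈ with r′ ← stays-in r u∈ = r′ ∷ walk-in rs (proj₁ (proj₂ r′))

  walk-out : ∀ {u v} → TransClosure (MonoArc full B merge) u v → lookup V₀ v ≡ false →
             TransClosure (MonoArc (∁ V₀) B φ₁) u v
  walk-out [ r ]    v∉ = [ stays-out r v∉ ]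
  walk-out (r ∷ rs) v∉ with rs′ ← walk-out rs v∉ = stays-out r (∈∁⁻ V₀ _ (source {S = ∁ V₀} rs′)) ∷ rs′

  merge-dicolouring : IsDicolouring c full B merge
  merge-dicolouring x cycle with lookup V₀ x in x?
  ... | true  = φ₀-dicol x (walk-in cycle x?)
  ... | false = φ₁-dicol x (walk-out cycle x?)

record Enumerates {m n} (f : Fin m → Fin n) (X : Subset n) : Set where
  field
    f∈X  : ∀ i → f i ∈ˢ X
    onto : ∀ {v} → v ∈ˢ X → ∃ λ i → f i ≡ v

module _ {m n c} {f : Fin m → Fin n} {X : Subset n} (enum : Enumerates f X) (φ : Fin n → Fin c) where
  open Enumerates enum

  constant⇒∣image∣≡1 : ∀ {r} → Fin m → (∀ i → φ (f i) ≡ r) → ∣ image φ X ∣ ≡ 1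
  constant⇒∣image∣≡1 i₀ constant = ∣image∣≡1 φ {X} (f∈X i₀) λ w∈X →
    let i , fi≡w = onto w∈X in trans (cong φ (sym fi≡w)) (trans (constant i) (sym (constant i₀)))

  onto⇒∣image∣≡c : (∀ j → ∃ λ i → φ (f i) ≡ j) → ∣ image φ X ∣ ≡ c
  onto⇒∣image∣≡c φf-onto = ∣image∣≡c φ {X} λ j → let i , φfi≡j = φf-onto j in f i , f∈X i , φfi≡j

Split : ℕ → ℕ → ℕ → Set
Split c a b = (a ≡ 1 × b ≡ c) ⊎ (a ≡ c × b ≡ 1)

module _ {c a b : ℕ} where

  Split-sym : Split c a b → Split c b a
  Split-sym = Sum.swap ∘ Sum.map Product.swap Product.swap

  Split-≡1 : Split c a b → b ≡ c → a ≡ 1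
  Split-≡1 (inj₁ (a≡1 , _))   _   = a≡1
  Split-≡1 (inj₂ (a≡c , b≡1)) b≡c = trans a≡c (trans (sym b≡c) b≡1)

  Split-≡c : Split c a b → a ≡ 1 → b ≡ c
  Split-≡c (inj₁ (_ , b≡c))   _   = b≡c
  Split-≡c (inj₂ (a≡c , b≡1)) a≡1 = trans b≡1 (trans (sym a≡1) a≡c)

uniformSplit : ∀ {c} {X Y : Set} {D₀ : X → Set} {D₁ : Y → Set} (f₀ : X → ℕ) (f₁ : Y → ℕ) →
               (∀ {x y} → D₀ x → D₁ y → Split c (f₀ x) (f₁ y)) → ∃ D₀ → ∃ D₁ →
               ((∀ x → D₀ x → f₀ x ≡ 1) × (∀ y → D₁ y → f₁ y ≡ c))
               ⊎ ((∀ y → D₁ y → f₁ y ≡ 1) × (∀ x → D₀ x → f₀ x ≡ c))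
uniformSplit f₀ f₁ split (x₀ , d₀) (y₀ , d₁) with split d₀ d₁
... | inj₁ (f₀x₀≡1 , f₁y₀≡c) =
  inj₁ ((λ x d → Split-≡1 (split d d₁) f₁y₀≡c) , (λ y d → Split-≡c (split d₀ d) f₀x₀≡1))
... | inj₂ (f₀x₀≡c , f₁y₀≡1) =
  inj₂ ((λ y d → Split-≡1 (Split-sym (split d₀ d)) f₀x₀≡c) , (λ x d → Split-≡c (Split-sym (split d d₁)) f₁y₀≡1))

-- Arcs between a vertex set and its complement

module _ {n} (G : Digraph n) (Y : Subset n) where

  lookup-N⁻ : ∀ u → lookup (N⁻ G Y) u ≡ not (lookup Y u) ∧ any (λ v → lookup Y v ∧ arc G u v) (allFin n)
  lookup-N⁻ = lookup∘tabulate _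

  lookup-N⁺ : ∀ v → lookup (N⁺ G Y) v ≡ not (lookup Y v) ∧ any (λ u → lookup Y u ∧ arc G u v) (allFin n)
  lookup-N⁺ = lookup∘tabulate _

  ∈N⁻⁺ : ∀ {u v} → lookup Y u ≡ false → v ∈ˢ Y → arc G u v ≡ true → u ∈ˢ N⁻ G Y
  ∈N⁻⁺ {u} {v} u∉ v∈ a = trans (lookup-N⁻ u) (∧-true⁺ (cong not u∉) (any-true⁺ _ (∈-allFin v) (∧-true⁺ v∈ a)))

  ∈N⁻⁻ : ∀ {u} → u ∈ˢ N⁻ G Y → lookup Y u ≡ false × ∃ λ v → v ∈ˢ Y × arc G u v ≡ true
  ∈N⁻⁻ {u} e with u∉ , arc∈ ← ∧-true⁻ (trans (sym (lookup-N⁻ u)) e) =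
    not-injective u∉ , Product.map₂ ∧-true⁻ (any-true⁻ _ (allFin n) arc∈)

  ∈N⁺⁺ : ∀ {u v} → u ∈ˢ Y → lookup Y v ≡ false → arc G u v ≡ true → v ∈ˢ N⁺ G Y
  ∈N⁺⁺ {u} {v} u∈ v∉ a = trans (lookup-N⁺ v) (∧-true⁺ (cong not v∉) (any-true⁺ _ (∈-allFin u) (∧-true⁺ u∈ a)))

  ∈N⁺⁻ : ∀ {v} → v ∈ˢ N⁺ G Y → lookup Y v ≡ false × ∃ λ u → u ∈ˢ Y × arc G u v ≡ true
  ∈N⁺⁻ {v} e with v∉ , arc∈ ← ∧-true⁻ (trans (sym (lookup-N⁺ v)) e) =
    not-injective v∉ , Product.map₂ ∧-true⁻ (any-true⁻ _ (allFin n) arc∈)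

module Crossing {n} (G : Digraph n) (V₀ : Subset n) where

  crosses : Fin n → Fin n → Bool
  crosses u v = lookup V₀ u ∧ lookup (∁ V₀) v ∧ arc G u v

  crosses⁺ : ∀ {u v} → u ∈ˢ V₀ → v ∈ˢ ∁ V₀ → arc G u v ≡ true → crosses u v ≡ true
  crosses⁺ u∈ v∈ a = ∧-true⁺ u∈ (∧-true⁺ v∈ a)

  crosses⁻ : ∀ {u v} → crosses u v ≡ true → u ∈ˢ V₀ × v ∈ˢ ∁ V₀ × arc G u v ≡ true
  crosses⁻ e with u∈ , rest ← ∧-true⁻ e = u∈ , ∧-true⁻ rest

  crossingArcs : List (Fin n × Fin n)
  crossingArcs = pairsWhere crosses (allFin n)

  crossingArc : Fin (length crossingArcs) → Fin n × Fin n
  crossingArc = List.lookup crossingArcs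

  crossingArc-crosses : ∀ i → let (u , v) = crossingArc i in u ∈ˢ V₀ × v ∈ˢ ∁ V₀ × arc G u v ≡ true
  crossingArc-crosses i = crosses⁻ {proj₁ (crossingArc i)} {proj₂ (crossingArc i)}
                                   (∈-pairsWhere⁻ crosses (allFin n) (∈-lookup i))

  crosses⇒crossingArc : ∀ {u v} → crosses u v ≡ true → ∃ λ i → crossingArc i ≡ (u , v)
  crosses⇒crossingArc {u} {v} e = index uv∈ , sym (lookup-index uv∈)
    where
    uv∈ : (u , v) ∈ˡ crossingArcs
    uv∈ = ∈-pairsWhere⁺ crosses (∈-allFin u) (∈-allFin v) e

  tails-enumerate : Enumerates (proj₁ ∘ crossingArc) (N⁻ G (∁ V₀))
  tails-enumerate = record { f∈X = tail∈ ; onto = tail-onto }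
    where
    tail∈ : ∀ i → proj₁ (crossingArc i) ∈ˢ N⁻ G (∁ V₀)
    tail∈ i with u∈ , v∈ , a ← crossingArc-crosses i = ∈N⁻⁺ G (∁ V₀) (∉∁⁺ V₀ _ u∈) v∈ a
    tail-onto : ∀ {u} → u ∈ˢ N⁻ G (∁ V₀) → ∃ λ i → proj₁ (crossingArc i) ≡ u
    tail-onto {u} u∈N⁻ with u∉∁ , v , v∈ , a ← ∈N⁻⁻ G (∁ V₀) u∈N⁻ =
      Product.map₂ (cong proj₁) (crosses⇒crossingArc (crosses⁺ (∉∁⁻ V₀ u u∉∁) v∈ a))

  heads-enumerate : Enumerates (proj₂ ∘ crossingArc) (N⁺ G V₀)
  heads-enumerate = record { f∈X = head∈ ; onto = head-onto }
    where
    head∈ : ∀ i → proj₂ (crossingArc i) ∈ˢ N⁺ G V₀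
    head∈ i with u∈ , v∈ , a ← crossingArc-crosses i = ∈N⁺⁺ G V₀ u∈ (∈∁⁻ V₀ _ v∈) a
    head-onto : ∀ {v} → v ∈ˢ N⁺ G V₀ → ∃ λ i → proj₂ (crossingArc i) ≡ v
    head-onto {v} v∈N⁺ with v∉ , u , u∈ , a ← ∈N⁺⁻ G V₀ v∈N⁺ =
      Product.map₂ (cong proj₂) (crosses⇒crossingArc (crosses⁺ u∈ (∈∁⁺ V₀ v v∉) a))

  module _ {c} .{{_ : NonZero c}} (¬dicolourable : ¬ Dicolourable c full (arc G))
           (few : countArcs G V₀ (∁ V₀) ≤ c) where

    crossingCell : ∀ (φ₀ φ₁ : Fin n → Fin c) → Fin (length crossingArcs) → Cell c
    crossingCell φ₀ φ₁ i = φ₀ (proj₁ (crossingArc i)) , φ₁ (proj₂ (crossingArc i))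

    -- Otherwise recolouring ∁ V₀ by σ and merging would dicolour G.
    crossingCells-meet : ∀ {φ₀ φ₁} → IsDicolouring c V₀ (arc G) φ₀ → IsDicolouring c (∁ V₀) (arc G) φ₁ →
                         ∀ σ → Injective _≡_ _≡_ σ → Meets (crossingCell φ₀ φ₁) σ
    crossingCells-meet {φ₀} {φ₁} φ₀-dicol φ₁-dicol σ σ-inj
      with any? (λ i → proj₁ (crossingCell φ₀ φ₁ i) ≟ σ (proj₂ (crossingCell φ₀ φ₁ i)))
    ... | yes (i , e) = _ , i , cong (_, _) e
    ... | no none = ⊥-elim (¬dicolourable (merge , merge-dicolouring))
      where
      rainbow : ∀ {u v} → u ∈ˢ V₀ → v ∈ˢ ∁ V₀ → arc G u v ≡ true → φ₀ u ≢ σ (φ₁ v)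
      rainbow u∈ v∈ a e with i , refl ← crosses⇒crossingArc (crosses⁺ u∈ v∈ a) = none (i , e)
      open Merge (arc G) V₀ φ₀-dicol (∘-dicolouring {S = ∁ V₀} σ-inj φ₁-dicol) rainbow

    crossingSplit : ∀ {φ₀ φ₁} → IsDicolouring c V₀ (arc G) φ₀ → IsDicolouring c (∁ V₀) (arc G) φ₁ →
                    Split c ∣ image φ₀ (N⁻ G (∁ V₀)) ∣ ∣ image φ₁ (N⁺ G V₀) ∣
    crossingSplit {φ₀} {φ₁} φ₀-dicol φ₁-dicol = fromLine (meetsAllPermutations⇒fullLine few-crossingArcs meet)
      where
      few-crossingArcs : length crossingArcs ≤ c
      few-crossingArcs = ≤-trans (≤-reflexive (length-pairsWhere crosses (allFin n))) few
      meet : ∀ σ → Injective _≡_ _≡_ σ → Meets (crossingCell φ₀ φ₁) σ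
      meet = crossingCells-meet φ₀-dicol φ₁-dicol
      i₀ : Fin (length crossingArcs)
      i₀ = proj₁ (proj₂ (meet id id))
      fromLine : ∃ (FullRow (crossingCell φ₀ φ₁)) ⊎ ∃ (FullColumn (crossingCell φ₀ φ₁)) →
                 Split c ∣ image φ₀ (N⁻ G (∁ V₀)) ∣ ∣ image φ₁ (N⁺ G V₀) ∣
      fromLine (inj₁ (_ , inRow , rowFull)) =
        inj₁ (constant⇒∣image∣≡1 tails-enumerate φ₀ i₀ inRow ,
              onto⇒∣image∣≡c heads-enumerate φ₁ (Product.map₂ (cong proj₂) ∘ rowFull))
      fromLine (inj₂ (_ , inColumn , columnFull)) =
        inj₂ (onto⇒∣image∣≡c tails-enumerate φ₀ (Product.map₂ (cong proj₁) ∘ columnFull) ,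
              constant⇒∣image∣≡1 heads-enumerate φ₁ i₀ inColumn)

lemma3p7 : (k n : ℕ) → 2 ≤ k → (G : Digraph n) → Dicritical k G →
    (V₀ : Subset n) → Nonempty V₀ → Nonempty (∁ V₀) →
    countArcs G V₀ (∁ V₀) ≤ k ∸ 1 →
    Conclusion G k V₀ (N⁻ G (∁ V₀)) (∁ V₀) (N⁺ G V₀)
    ⊎ Conclusion G k (∁ V₀) (N⁺ G V₀) V₀ (N⁻ G (∁ V₀))
lemma3p7 1 _ (s≤s ())
lemma3p7 (suc (suc c)) n _ G ((_ , ¬dicolourable) , critical) V₀ (v₀ , v₀∈V₀) (v₁ , v₁∈V₁) few =
  uniformSplit (λ φ → ∣ image φ (N⁻ G (∁ V₀)) ∣) (λ φ → ∣ image φ (N⁺ G V₀) ∣)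
    (crossingSplit ¬dicolourable few)
    (induced-dicolourable G {V₀} critical (∈∁⁻ V₀ v₁ ([]=⇒lookup v₁∈V₁)))
    (induced-dicolourable G {∁ V₀} critical (∉∁⁺ V₀ v₀ ([]=⇒lookup v₀∈V₀)))
  where open Crossing G V₀
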